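{- Let $G=(V,E)$ be a twinless strongly connected directed graph. Let $E_{t}\subseteq E$ be an optimal solution for the MTSCSS problem on $G$ and let $E_{s}\subseteq E$ be an optimal solution for the MSCSS problem on $G$. Then $|E_{t}|=|E_{s}|$.
   Context: Directed graphs are finite with no loops and no parallel edges. A directed graph is twinless strongly connected if for every pair of vertices $a,b$ there is a directed path $p$ from $a$ to $b$ and a directed path $q$ from $b$ to $a$ such that for every edge $(c,d)$ of $p$, the edge $(d,c)$ is not an edge of $q$. MTSCSS problem: find a minimum-cardinality $E_{1}\subseteq E$ such that $(V,E_{1})$ is twinless strongly connected. MSCSS problem: find a minimum-cardinality $E_{1}\subseteq E$ such that $(V,E_{1})$ is strongly connected. -}

module Defs where

open import Data.Nat using (ℕ; zero; suc; _≤_)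
open import Data.Bool using (Bool; true; false; if_then_else_)
open import Data.Fin using (Fin)
open import Data.List using (List; []; _∷_; map; allFin)
open import Data.Nat.ListAction using (sum)
open import Data.List.Relation.Unary.Unique.Propositional using (Unique)
open import Data.Product using (Σ; _×_; _,_)
open import Relation.Binary.PropositionalEquality using (_≡_)
open import Relation.Nullary using (¬_)

-- A (simple) directed graph on vertex set Fin n is given by its edge set,
-- a Boolean adjacency relation: E i j ≡ true iff (i , j) is an edge.
-- This representation excludes parallel edges automatically.
EdgeSet : ℕ → Set
EdgeSet n = Fin n → Fin n → Bool

Loopless : {n : ℕ} → EdgeSet n → Set
Loopless {n} E = (i : Fin n) → E i i ≡ false

_⊆E_ : {n : ℕ} → EdgeSet n → EdgeSet n → Set
_⊆E_ {n} E₁ E = (i j : Fin n) → E₁ i j ≡ true → E i j ≡ true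

edgeCount : {n : ℕ} → EdgeSet n → ℕ
edgeCount {n} E =
  sum (map (λ i → sum (map (λ j → if E i j then 1 else 0) (allFin n))) (allFin n))

data Walk {n : ℕ} (E : EdgeSet n) : Fin n → Fin n → Set where
  here : {a : Fin n} → Walk E a a
  step : {a b c : Fin n} → E a b ≡ true → Walk E b c → Walk E a c

vertices : {n : ℕ} {E : EdgeSet n} {a b : Fin n} → Walk E a b → List (Fin n)
vertices {a = a} here = a ∷ []
vertices {a = a} (step _ w) = a ∷ vertices w

record Path {n : ℕ} (E : EdgeSet n) (a b : Fin n) : Set where
  constructor mkPath
  field
    walk   : Walk E a b
    simple : Unique (vertices walk)

data EdgeOfWalk {n : ℕ} {E : EdgeSet n} : {a b : Fin n} → Walk E a b → Fin n → Fin n → Set where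
  first : {a b c : Fin n} (e : E a b ≡ true) (w : Walk E b c) → EdgeOfWalk (step e w) a b
  later : {a b c x y : Fin n} (e : E a b ≡ true) (w : Walk E b c) →
          EdgeOfWalk w x y → EdgeOfWalk (step e w) x y

EdgeOf : {n : ℕ} {E : EdgeSet n} {a b : Fin n} → Path E a b → Fin n → Fin n → Set
EdgeOf p = EdgeOfWalk (Path.walk p)

StronglyConnected : {n : ℕ} → EdgeSet n → Set
StronglyConnected {n} E = (a b : Fin n) → Path E a b

TwinlessStronglyConnected : {n : ℕ} → EdgeSet n → Set
TwinlessStronglyConnected {n} E =
  (a b : Fin n) → Σ (Path E a b) λ p → Σ (Path E b a) λ q →
    (c d : Fin n) → EdgeOf p c d → ¬ EdgeOf q d c

IsOptimalMTSCSS : {n : ℕ} → EdgeSet n → EdgeSet n → Set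
IsOptimalMTSCSS {n} E E₁ =
  (E₁ ⊆E E) × TwinlessStronglyConnected E₁ ×
  ((E' : EdgeSet n) → E' ⊆E E → TwinlessStronglyConnected E' → edgeCount E₁ ≤ edgeCount E')

IsOptimalMSCSS : {n : ℕ} → EdgeSet n → EdgeSet n → Set
IsOptimalMSCSS {n} E E₁ =
  (E₁ ⊆E E) × StronglyConnected E₁ ×
  ((E' : EdgeSet n) → E' ⊆E E → StronglyConnected E' → edgeCount E₁ ≤ edgeCount E')

module Submission where

-- Every twinless strongly connected subgraph is strongly connected, so the
-- MSCSS optimum is at most the MTSCSS optimum.  For the converse we show that
-- some minimum strongly connected spanning subgraph H ⊆ E has no pair of
-- antiparallel edges ("twins"); such an H is twinless strongly connected.
-- Among minimum subgraphs take one with the fewest twin pairs.  If it still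
-- had twins (x , y) and (y , x), deleting either one would destroy strong
-- connectivity (by minimality).  Let X be the set reached from x once (x , y)
-- is deleted; then (x , y) is the only edge of H leaving X and (y , x) the only
-- edge entering it.  A path from x to y in E leaves X by an edge (a , b); if
-- (a , b) ≠ (x , y), exchanging (x , y) for (a , b) keeps H strongly connected,
-- keeps its size and removes the twin pair ("the exchange lemma").  Applying
-- this to both paths of a twinless pair x → y, y → x in G (the second time with
-- x and y swapped) yields such an exchange, because the two paths cannot use
-- (x , y) and (y , x) respectively.
--
-- Reachability is only used to split into cases, so
-- the descent is carried out in the double-negation monad and the (decidable)
-- inequality is recovered at the end.

open import Defs
open import Algebra.Properties.CommutativeSemigroup using (xy∙z≈zy∙x; xy∙z≈xz∙y; x∙yz≈xy∙z; x∙yz≈xz∙y)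
open import Data.Bool using (Bool; true; false; if_then_else_; _∧_)
open import Data.Bool.Properties using (¬-not)
import Data.Bool as Bool
open import Data.Empty using (⊥; ⊥-elim)
open import Data.Fin using (Fin; zero; suc; _≟_)
open import Data.Fin.Properties using (any?; suc-injective)
open import Data.List using (map; tabulate; allFin)
open import Data.List.Membership.Propositional using (_∈_)
open import Data.List.Relation.Unary.All using ([])
open import Data.List.Relation.Unary.All.Properties.Core using (¬Any⇒All¬)
open import Data.List.Relation.Unary.AllPairs using ([]; _∷_)
open import Data.List.Relation.Unary.Any using (here; there) renaming (any? to anyList?)
open import Data.List.Relation.Unary.Unique.Propositional using (Unique)
open import Data.Nat using (ℕ; zero; suc; _+_; _≤_; _<_; _≤?_; z≤n; s≤s)
open import Data.Nat.ListAction using (sum)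
open import Data.Nat.Properties
  using (≤-refl; ≤-trans; ≤-antisym; ≤-pred; ≤-reflexive; <-≤-trans; <⇒≱; +-mono-≤;
         +-mono-<-≤; +-mono-≤-<; +-assoc; +-cancelʳ-≡; +-commutativeSemigroup)
open import Data.Product using (Σ; ∃; _×_; _,_; proj₁; proj₂)
open import Data.Sum using (_⊎_; inj₁; inj₂)
open import Function using (_∘_)
open import Relation.Nullary using (¬_; Dec; yes; no)
open import Relation.Nullary.Decidable using (_×-dec_; decidable-stable; ¬¬-excluded-middle)
open import Relation.Nullary.Negation using (DoubleNegation; ¬¬-map)
open import Relation.Binary.PropositionalEquality

variable
  n : ℕ

ind : Bool → ℕ
ind b = if b then 1 else 0

sumFin : (Fin n → ℕ) → ℕ
sumFin {zero}  f = 0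
sumFin {suc n} f = f zero + sumFin (f ∘ suc)

sum-map-tabulate : {A : Set} (f : A → ℕ) (g : Fin n → A) →
                   sum (map f (tabulate g)) ≡ sumFin (f ∘ g)
sum-map-tabulate {zero}  f g = refl
sum-map-tabulate {suc n} f g = cong (f (g zero) +_) (sum-map-tabulate f (g ∘ suc))

sumFin-cong : (f g : Fin n → ℕ) → (∀ i → f i ≡ g i) → sumFin f ≡ sumFin g
sumFin-cong {zero}  f g eq = refl
sumFin-cong {suc n} f g eq = cong₂ _+_ (eq zero) (sumFin-cong _ _ (eq ∘ suc))

sumFin-mono : (f g : Fin n → ℕ) → (∀ i → f i ≤ g i) → sumFin f ≤ sumFin g
sumFin-mono {zero}  f g le = z≤n
sumFin-mono {suc n} f g le = +-mono-≤ (le zero) (sumFin-mono _ _ (le ∘ suc))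

sumFin-strict : (f g : Fin n → ℕ) (k : Fin n) → (∀ i → f i ≤ g i) → f k < g k →
                sumFin f < sumFin g
sumFin-strict {suc n} f g zero    le lt = +-mono-<-≤ lt (sumFin-mono _ _ (le ∘ suc))
sumFin-strict {suc n} f g (suc k) le lt = +-mono-≤-< (le zero) (sumFin-strict _ _ k (le ∘ suc) lt)

sumFin-point : (f g : Fin n → ℕ) (k : Fin n) → (∀ i → i ≢ k → f i ≡ g i) →
               sumFin f + g k ≡ sumFin g + f k
sumFin-point {suc n} f g zero agree = begin
  (f zero + sumFin (f ∘ suc)) + g zero ≡⟨ cong (λ s → (f zero + s) + g zero) tails ⟩
  (f zero + sumFin (g ∘ suc)) + g zero ≡⟨ xy∙z≈zy∙x +-commutativeSemigroup (f zero) _ (g zero) ⟩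
  (g zero + sumFin (g ∘ suc)) + f zero ∎
  where
  open ≡-Reasoning
  tails : sumFin (f ∘ suc) ≡ sumFin (g ∘ suc)
  tails = sumFin-cong _ _ (λ i → agree (suc i) (λ ()))
sumFin-point {suc n} f g (suc k) agree = begin
  (f zero + sumFin (f ∘ suc)) + g (suc k) ≡⟨ +-assoc (f zero) _ _ ⟩
  f zero + (sumFin (f ∘ suc) + g (suc k)) ≡⟨ cong₂ _+_ (agree zero (λ ())) tails ⟩
  g zero + (sumFin (g ∘ suc) + f (suc k)) ≡⟨ x∙yz≈xy∙z +-commutativeSemigroup (g zero) _ (f (suc k)) ⟩
  (g zero + sumFin (g ∘ suc)) + f (suc k) ∎
  where
  open ≡-Reasoning
  tails : sumFin (f ∘ suc) + g (suc k) ≡ sumFin (g ∘ suc) + f (suc k)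
  tails = sumFin-point (f ∘ suc) (g ∘ suc) k (λ i i≢k → agree (suc i) (i≢k ∘ suc-injective))

edgeCount-sumFin : (H : EdgeSet n) → edgeCount H ≡ sumFin (λ i → sumFin (λ j → ind (H i j)))
edgeCount-sumFin {n} H =
  trans (sum-map-tabulate (λ i → sum (map (λ j → ind (H i j)) (allFin n))) (λ i → i))
        (sumFin-cong _ _ (λ i → sum-map-tabulate (λ j → ind (H i j)) (λ j → j)))

ind-mono : {b b′ : Bool} → (b′ ≡ true → b ≡ true) → ind b′ ≤ ind b
ind-mono {true}  {true}  _ = ≤-refl
ind-mono {false} {true}  f with f refl
... | ()
ind-mono {_}     {false} _ = z≤n

edgeCount-strict : {H H′ : EdgeSet n} {x y : Fin n} → H′ ⊆E H →
                   H x y ≡ true → H′ x y ≡ false → edgeCount H′ < edgeCount H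
edgeCount-strict {H = H} {H′} {x} {y} H′⊆H Hxy H′xy
  rewrite edgeCount-sumFin H | edgeCount-sumFin H′ =
  sumFin-strict _ _ x (λ i → sumFin-mono _ _ (λ j → ind-mono (H′⊆H i j)))
    (sumFin-strict _ _ y (λ j → ind-mono (H′⊆H x j)) ind-lt)
  where
  ind-lt : ind (H′ x y) < ind (H x y)
  ind-lt rewrite Hxy | H′xy = s≤s z≤n

setEdge : EdgeSet n → Fin n → Fin n → Bool → EdgeSet n
setEdge H x y v i j with (i ≟ x) ×-dec (j ≟ y)
... | yes _ = v
... | no  _ = H i j

removeEdge addEdge : EdgeSet n → Fin n → Fin n → EdgeSet n
removeEdge H x y = setEdge H x y false
addEdge    H x y = setEdge H x y true

setEdge-same : (H : EdgeSet n) (x y : Fin n) (v : Bool) → setEdge H x y v x y ≡ v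
setEdge-same H x y v with (x ≟ x) ×-dec (y ≟ y)
... | yes _ = refl
... | no ne = ⊥-elim (ne (refl , refl))

setEdge-other : (H : EdgeSet n) {x y i j : Fin n} (v : Bool) → ¬ (i ≡ x × j ≡ y) →
                setEdge H x y v i j ≡ H i j
setEdge-other H {x} {y} {i} {j} v ne with (i ≟ x) ×-dec (j ≟ y)
... | yes p = ⊥-elim (ne p)
... | no  _ = refl

addEdge-cases : (H : EdgeSet n) {a b i j : Fin n} → addEdge H a b i j ≡ true →
                (i ≡ a × j ≡ b) ⊎ H i j ≡ true
addEdge-cases H {a} {b} {i} {j} e with (i ≟ a) ×-dec (j ≟ b)
... | yes p = inj₁ p
... | no  _ = inj₂ e

addEdge-⊇ : (H : EdgeSet n) (a b : Fin n) → H ⊆E addEdge H a b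
addEdge-⊇ H a b i j e with (i ≟ a) ×-dec (j ≟ b)
... | yes _ = refl
... | no  _ = e

removeEdge-edge : (H : EdgeSet n) {x y i j : Fin n} → removeEdge H x y i j ≡ true →
                  ¬ (i ≡ x × j ≡ y) × H i j ≡ true
removeEdge-edge H {x} {y} {i} {j} e with (i ≟ x) ×-dec (j ≟ y)
removeEdge-edge H () | yes _
... | no ne = ne , e

removeEdge-⊆ : (H : EdgeSet n) (x y : Fin n) → removeEdge H x y ⊆E H
removeEdge-⊆ H x y i j = proj₂ ∘ removeEdge-edge H

removeEdge-keeps : (H : EdgeSet n) {x y i j : Fin n} → ¬ (i ≡ x × j ≡ y) →
                   H i j ≡ true → removeEdge H x y i j ≡ true
removeEdge-keeps H ne e = trans (setEdge-other H false ne) e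

-- Additive bookkeeping used to combine the row and column effects of an update.
transfer : (a b r r′ i v : ℕ) → a + r ≡ b + r′ → r′ + i ≡ r + v → a + i ≡ b + v
transfer a b r r′ i v outer inner = +-cancelʳ-≡ r _ _ (begin
  (a + i) + r  ≡⟨ xy∙z≈xz∙y +-commutativeSemigroup a i r ⟩
  (a + r) + i  ≡⟨ cong (_+ i) outer ⟩
  (b + r′) + i ≡⟨ +-assoc b r′ i ⟩
  b + (r′ + i) ≡⟨ cong (b +_) inner ⟩
  b + (r + v)  ≡⟨ x∙yz≈xz∙y +-commutativeSemigroup b r v ⟩
  (b + v) + r  ∎)
  where open ≡-Reasoning

edgeCount-setEdge : (H : EdgeSet n) (x y : Fin n) (v : Bool) →
                    edgeCount (setEdge H x y v) + ind (H x y) ≡ edgeCount H + ind v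
edgeCount-setEdge H x y v
  rewrite edgeCount-sumFin (setEdge H x y v) | edgeCount-sumFin H =
  transfer _ _ (row H x) (row U x) _ _ rows (trans columns (cong (λ b → row H x + ind b) (setEdge-same H x y v)))
  where
  U = setEdge H x y v
  row : EdgeSet _ → Fin _ → ℕ
  row K i = sumFin (λ j → ind (K i j))
  rows : sumFin (row U) + row H x ≡ sumFin (row H) + row U x
  rows = sumFin-point (row U) (row H) x
           (λ i i≢x → sumFin-cong _ _ (λ j → cong ind (setEdge-other H {x} {y} {i} {j} v (i≢x ∘ proj₁))))
  columns : row U x + ind (H x y) ≡ row H x + ind (U x y)
  columns = sumFin-point _ _ y (λ j j≢y → cong ind (setEdge-other H {x} {y} {x} {j} v (j≢y ∘ proj₂)))

edgeCount-exchange : (H : EdgeSet n) {x y a b : Fin n} → H x y ≡ true → H a b ≡ false →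
                     ¬ (a ≡ x × b ≡ y) → edgeCount (addEdge (removeEdge H x y) a b) ≡ edgeCount H
edgeCount-exchange H {x} {y} {a} {b} Hxy Hab ab≢xy = +-cancelʳ-≡ 0 _ _ (begin
  edgeCount H′ + 0              ≡⟨ cong (λ e → edgeCount H′ + ind e) H₁ab ⟨
  edgeCount H′ + ind (H₁ a b)   ≡⟨ edgeCount-setEdge H₁ a b true ⟩
  edgeCount H₁ + 1              ≡⟨ cong (λ e → edgeCount H₁ + ind e) Hxy ⟨
  edgeCount H₁ + ind (H x y)    ≡⟨ edgeCount-setEdge H x y false ⟩
  edgeCount H + 0               ∎)
  where
  open ≡-Reasoning
  H₁ = removeEdge H x y
  H′ = addEdge H₁ a b
  H₁ab : H₁ a b ≡ false
  H₁ab = trans (setEdge-other H false ab≢xy) Hab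

∧-true : {a b : Bool} → a ≡ true → b ≡ true → a ∧ b ≡ true
∧-true refl refl = refl

∧-split : {a b : Bool} → a ∧ b ≡ true → a ≡ true × b ≡ true
∧-split {true} {true} _ = refl , refl

twins : EdgeSet n → EdgeSet n
twins H i j = H i j ∧ H j i

twinCount : EdgeSet n → ℕ
twinCount H = edgeCount (twins H)

twinCount-< : {H H′ : EdgeSet n} {x y : Fin n} →
              (∀ i j → H′ i j ≡ true → H′ j i ≡ true → H i j ≡ true) →
              H x y ≡ true → H y x ≡ true → H′ x y ≡ false → twinCount H′ < twinCount H
twinCount-< {H = H} {H′} {x} {y} old Hxy Hyx H′xy =
  edgeCount-strict twins⊆ (∧-true Hxy Hyx) (cong (_∧ H′ y x) H′xy)
  where
  twins⊆ : twins H′ ⊆E twins H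
  twins⊆ i j e with ∧-split {H′ i j} e
  ... | eij , eji = ∧-true (old i j eij eji) (old j i eji eij)

infixr 5 _++w_
_++w_ : {H : EdgeSet n} {a b c : Fin n} → Walk H a b → Walk H b c → Walk H a c
here     ++w v = v
step e w ++w v = step e (w ++w v)

walk-mono : {H K : EdgeSet n} {a b : Fin n} → H ⊆E K → Walk H a b → Walk K a b
walk-mono H⊆K here       = here
walk-mono H⊆K (step e w) = step (H⊆K _ _ e) (walk-mono H⊆K w)

edgeOfWalk-edge : {H : EdgeSet n} {a b c d : Fin n} {w : Walk H a b} →
                  EdgeOfWalk w c d → H c d ≡ true
edgeOfWalk-edge (first e w)   = e
edgeOfWalk-edge (later e w p) = edgeOfWalk-edge p

suffixFrom : {H : EdgeSet n} {a b c : Fin n} (w : Walk H b c) →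
             Unique (vertices w) → a ∈ vertices w → Path H a c
suffixFrom here       u       (here refl) = mkPath here u
suffixFrom (step e w) u       (here refl) = mkPath (step e w) u
suffixFrom (step e w) (_ ∷ u) (there a∈w) = suffixFrom w u a∈w

walk→path : {H : EdgeSet n} {a b : Fin n} → Walk H a b → Path H a b
walk→path here = mkPath here ([] ∷ [])
walk→path {a = a} (step e w) with walk→path w
... | mkPath w′ u with anyList? (a ≟_) (vertices w′)
...   | yes a∈w′ = suffixFrom w′ u a∈w′
...   | no  a∉w′ = mkPath (step e w′) (¬Any⇒All¬ _ a∉w′ ∷ u)

Connected : EdgeSet n → Set
Connected {n} H = (a b : Fin n) → Walk H a b

connected→strong : {H : EdgeSet n} → Connected H → StronglyConnected H
connected→strong conn a b = walk→path (conn a b)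

strong→connected : {H : EdgeSet n} → StronglyConnected H → Connected H
strong→connected sc a b = Path.walk (sc a b)

-- A walk into x only uses edges leaving vertices other than x (up to its first
-- visit of x); so it survives in any K containing those edges of H.
walk-into : {H K : EdgeSet n} (x : Fin n) →
            (∀ a b → a ≢ x → H a b ≡ true → K a b ≡ true) →
            {v : Fin n} → Walk H v x → Walk K v x
walk-into x keep here = here
walk-into x keep {v} (step e w) with v ≟ x
... | yes refl = here
... | no  v≢x  = step (keep _ _ v≢x e) (walk-into x keep w)

twinFree→twinless : {H : EdgeSet n} → Connected H →
                    (∀ c d → H c d ≡ true → H d c ≡ true → ⊥) → TwinlessStronglyConnected H
twinFree→twinless conn twinFree a b =
  walk→path (conn a b) , walk→path (conn b a) ,
  λ c d cd∈p dc∈q → twinFree c d (edgeOfWalk-edge cd∈p) (edgeOfWalk-edge dc∈q)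

MinimumSC : EdgeSet n → EdgeSet n → Set
MinimumSC {n} E H =
  H ⊆E E × Connected H × ((K : EdgeSet n) → K ⊆E E → Connected K → edgeCount H ≤ edgeCount K)

record Improvement (E H : EdgeSet n) : Set where
  field
    graph      : EdgeSet n
    graph⊆E    : graph ⊆E E
    connected  : Connected graph
    size≤      : edgeCount graph ≤ edgeCount H
    fewerTwins : twinCount graph < twinCount H

module Exchange {E H : EdgeSet n} (H⊆E : H ⊆E E) (conn : Connected H)
                {x y : Fin n} (x≢y : x ≢ y) (Hxy : H x y ≡ true) (Hyx : H y x ≡ true)
                (cut-xy : ¬ Connected (removeEdge H x y))
                (cut-yx : ¬ Connected (removeEdge H y x))
                (X? : ∀ v → Dec (Walk (removeEdge H x y) x v)) where

  H₁ H₂ H₀ : EdgeSet n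
  H₁ = removeEdge H x y
  H₂ = removeEdge H y x
  H₀ = removeEdge H₁ y x

  H₁⊆H : H₁ ⊆E H
  H₁⊆H = removeEdge-⊆ H x y

  H₀⊆H₁ : H₀ ⊆E H₁
  H₀⊆H₁ = removeEdge-⊆ H₁ y x

  H₀⊆H₂ : H₀ ⊆E H₂
  H₀⊆H₂ i j e with removeEdge-edge H₁ e
  ... | ij≢yx , e₁ = removeEdge-keeps H ij≢yx (H₁⊆H i j e₁)

  H₂xy : H₂ x y ≡ true
  H₂xy = removeEdge-keeps H (x≢y ∘ proj₁) Hxy

  ⇝x : ∀ v → Walk H₁ v x
  ⇝x v = walk-into x (λ a b a≢x → removeEdge-keeps H (a≢x ∘ proj₁)) (conn v x)

  ⇝y : ∀ v → Walk H₂ v y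
  ⇝y v = walk-into y (λ a b a≢y → removeEdge-keeps H (a≢y ∘ proj₁)) (conn v y)

  -- The part of a walk after its last use of (x , y) or (y , x) lies in H₀.
  lastSegment : {s t : Fin n} → Walk H s t → Walk H₀ s t ⊎ Walk H₀ x t ⊎ Walk H₀ y t
  lastSegment here = inj₁ here
  lastSegment {s} (step {b = b} e w) with lastSegment w
  ... | inj₂ r = inj₂ r
  ... | inj₁ r with (s ≟ x) ×-dec (b ≟ y) | (s ≟ y) ×-dec (b ≟ x)
  ...   | yes (refl , refl) | _                 = inj₂ (inj₂ r)
  ...   | no _              | yes (refl , refl) = inj₂ (inj₁ r)
  ...   | no sb≢xy          | no sb≢yx          =
          inj₁ (step (removeEdge-keeps H₁ sb≢yx (removeEdge-keeps H sb≢xy e)) r)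

  -- A supergraph of H₀ in which x reaches y and every vertex reaches x is
  -- strongly connected: go to x, then follow the last segment of an H-walk.
  hub-connected : {K : EdgeSet n} → H₀ ⊆E K → Walk K x y → (∀ v → Walk K v x) → Connected K
  hub-connected {K} H₀⊆K x⇝y to-x a b = to-x a ++w x⇝b
    where
    x⇝b : Walk K x b
    x⇝b with lastSegment (conn x b)
    ... | inj₁ r        = walk-mono H₀⊆K r
    ... | inj₂ (inj₁ r) = walk-mono H₀⊆K r
    ... | inj₂ (inj₂ r) = x⇝y ++w walk-mono H₀⊆K r

  X : Fin n → Set
  X v = Walk H₁ x v

  y∉X : ¬ X y
  y∉X x⇝y = cut-xy (hub-connected H₀⊆H₁ x⇝y ⇝x)

  leave-X : ∀ {u w} → X u → H u w ≡ true → ¬ X w → u ≡ x × w ≡ y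
  leave-X {u} {w} xu e w∉X with (u ≟ x) ×-dec (w ≟ y)
  ... | yes uw≡xy = uw≡xy
  ... | no  uw≢xy = ⊥-elim (w∉X (xu ++w step (removeEdge-keeps H uw≢xy e) here))

  -- An H₁-walk starting in X stays in X, so it avoids (y , x) because y ∉ X.
  walk-from-X : ∀ {w t} → X w → Walk H₁ w t → Walk H₂ w t
  walk-from-X xw here = here
  walk-from-X {w} xw (step {b = b} e r) with (w ≟ y) ×-dec (b ≟ x)
  ... | yes (refl , refl) = ⊥-elim (y∉X xw)
  ... | no  wb≢yx         =
        step (removeEdge-keeps H wb≢yx (H₁⊆H w b e)) (walk-from-X (xw ++w step e here) r)

  y⇝outside : ∀ {u} → ¬ X u → Walk H₀ y u
  y⇝outside {u} u∉X with lastSegment (conn y u)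
  ... | inj₁ r        = r
  ... | inj₂ (inj₁ r) = ⊥-elim (u∉X (walk-mono H₀⊆H₁ r))
  ... | inj₂ (inj₂ r) = r

  -- (y , x) is the only edge of H entering X: any other one would give a
  -- walk from y to x avoiding (y , x), making H₂ strongly connected.
  enter-X : ∀ {u w} → ¬ X u → H u w ≡ true → X w → u ≡ y × w ≡ x
  enter-X {u} {w} u∉X e xw with (u ≟ y) ×-dec (w ≟ x)
  ... | yes uw≡yx = uw≡yx
  ... | no  uw≢yx = ⊥-elim (cut-yx (hub-connected H₀⊆H₂ (step H₂xy here) (λ v → ⇝y v ++w y⇝x)))
    where
    y⇝x : Walk H₂ y x
    y⇝x = walk-mono H₀⊆H₂ (y⇝outside u∉X) ++w
          step (removeEdge-keeps H uw≢yx e) (walk-from-X xw (⇝x w))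

  -- From outside X, an H-walk into X first enters X through (y , x); its
  -- part before that is an H₁-walk to y.
  outside⇝y : ∀ {b t} → ¬ X b → Walk H b t → X t → Walk H₁ b y
  outside⇝y b∉X here xt = ⊥-elim (b∉X xt)
  outside⇝y {b} b∉X (step {b = c} e w) xt with X? c
  ... | yes xc with enter-X b∉X e xc
  ...   | refl , refl = here
  outside⇝y {b} b∉X (step {b = c} e w) xt | no c∉X =
    step (removeEdge-keeps H (λ bc≡xy → b∉X (subst X (sym (proj₁ bc≡xy)) here)) e)
         (outside⇝y c∉X w xt)

  record ExitEdge {s t : Fin n} (w : Walk E s t) : Set where
    constructor exitEdge
    field
      from to : Fin n
      onWalk  : EdgeOfWalk w from to
      from∈X  : X from
      to∉X    : ¬ X to

  firstExit : ∀ {s t} (w : Walk E s t) → X s → ¬ X t → ExitEdge w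
  firstExit here xs t∉X = ⊥-elim (t∉X xs)
  firstExit {s} (step {b = c} e w) xs t∉X with X? c
  ... | yes xc = let exitEdge a b on xa b∉X = firstExit w xc t∉X in
                 exitEdge a b (later e w on) xa b∉X
  ... | no c∉X = exitEdge s c (first e w) xs c∉X

  -- Exchanging (x , y) for an edge (a , b) ≠ (x , y) of E leaving X is an
  -- improvement: x ⇝ a ⟶ b ⇝ y replaces the edge (x , y), and the new edge
  -- has no twin since (y , x) is the only edge of H entering X.
  exchange-edge : ∀ {a b} → E a b ≡ true → X a → ¬ X b → ¬ (a ≡ x × b ≡ y) → Improvement E H
  exchange-edge {a} {b} Eab xa b∉X ab≢xy = record
    { graph      = H′
    ; graph⊆E    = H′⊆E
    ; connected  = hub-connected (λ i j → H₁⊆H′ i j ∘ H₀⊆H₁ i j) x⇝y (λ v → walk-mono H₁⊆H′ (⇝x v))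
    ; size≤      = ≤-reflexive (edgeCount-exchange H Hxy Hab ab≢xy)
    ; fewerTwins = twinCount-< old-twin Hxy Hyx H′xy
    }
    where
    H′ : EdgeSet n
    H′ = addEdge H₁ a b
    H₁⊆H′ : H₁ ⊆E H′
    H₁⊆H′ = addEdge-⊇ H₁ a b
    H′⊆E : H′ ⊆E E
    H′⊆E i j e with addEdge-cases H₁ {a} {b} {i} {j} e
    ... | inj₁ (refl , refl) = Eab
    ... | inj₂ e₁            = H⊆E i j (H₁⊆H i j e₁)
    Hab : H a b ≡ false
    Hab = ¬-not (λ e → ab≢xy (leave-X xa e b∉X))
    x⇝y : Walk H′ x y
    x⇝y = walk-mono H₁⊆H′ xa ++w
          step (setEdge-same H₁ a b true) (walk-mono H₁⊆H′ (outside⇝y b∉X (conn b x) here))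
    H′xy : H′ x y ≡ false
    H′xy = trans (setEdge-other H₁ true (λ (x≡a , y≡b) → ab≢xy (sym x≡a , sym y≡b)))
                 (setEdge-same H x y false)
    old-twin : ∀ i j → H′ i j ≡ true → H′ j i ≡ true → H i j ≡ true
    old-twin i j eij eji with addEdge-cases H₁ {a} {b} {i} {j} eij
    ... | inj₂ e₁ = H₁⊆H i j e₁
    ... | inj₁ (refl , refl) with addEdge-cases H₁ {a} {b} {b} {a} eji
    ...   | inj₁ (b≡a , _) = ⊥-elim (b∉X (subst X (sym b≡a) xa))
    ...   | inj₂ e₁ with enter-X b∉X (H₁⊆H b a e₁) xa
    ...     | b≡y , a≡x = ⊥-elim (ab≢xy (a≡x , b≡y))

  exchange : (w : Walk E x y) → Improvement E H ⊎ EdgeOfWalk w x y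
  exchange w with firstExit w here y∉X
  ... | exitEdge a b on xa b∉X with (a ≟ x) ×-dec (b ≟ y)
  ...   | yes (refl , refl) = inj₂ on
  ...   | no  ab≢xy         = inj₁ (exchange-edge (edgeOfWalk-edge on) xa b∉X ab≢xy)

¬¬-decide-all : (Q : Fin n → Set) → DoubleNegation (∀ i → Dec (Q i))
¬¬-decide-all {zero}  Q k = k (λ ())
¬¬-decide-all {suc n} Q k =
  ¬¬-excluded-middle λ Q₀? → ¬¬-decide-all (Q ∘ suc) λ Qₛ? →
  k (λ { zero → Q₀? ; (suc i) → Qₛ? i })

twinPair? : (H : EdgeSet n) → Dec (∃ λ x → ∃ λ y → H x y ≡ true × H y x ≡ true)
twinPair? H = any? λ x → any? λ y → (H x y Bool.≟ true) ×-dec (H y x Bool.≟ true)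

indispensable : {E H : EdgeSet n} {a b : Fin n} → MinimumSC E H → H a b ≡ true →
                ¬ Connected (removeEdge H a b)
indispensable {H = H} {a} {b} (H⊆E , _ , least) Hab conn′ =
  <⇒≱ (edgeCount-strict (removeEdge-⊆ H a b) Hab (setEdge-same H a b false))
      (least _ (λ i j → H⊆E i j ∘ removeEdge-⊆ H a b i j) conn′)

-- In a twinless strongly connected loopless E, every twin pair of a minimum
-- strongly connected subgraph can be traded away: apply the exchange lemma to
-- the two paths of a twinless pair x → y, y → x, the second time with x and y
-- swapped; if neither application improves H, the paths use (x , y) and
-- (y , x) respectively, contradicting twinlessness.
improve : {E H : EdgeSet n} {x y : Fin n} → Loopless E → TwinlessStronglyConnected E →
          MinimumSC E H → H x y ≡ true → H y x ≡ true → DoubleNegation (Improvement E H)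
improve {n} {E} {H} {x} {y} loopless tsc min@(H⊆E , conn , _) Hxy Hyx no-improvement =
  ¬¬-decide-all (Walk (removeEdge H x y) x) λ X? →
  ¬¬-decide-all (Walk (removeEdge H y x) y) λ Y? →
  conclude X? Y? (tsc x y)
  where
  x≢y : x ≢ y
  x≢y refl with trans (sym (H⊆E x x Hxy)) (loopless x)
  ... | ()
  conclude : (∀ v → Dec (Walk (removeEdge H x y) x v)) → (∀ v → Dec (Walk (removeEdge H y x) y v)) →
             Σ (Path E x y) (λ p → Σ (Path E y x) λ q → (c d : Fin n) → EdgeOf p c d → ¬ EdgeOf q d c) → ⊥
  conclude X? Y? (p , q , twinless)
    with Exchange.exchange H⊆E conn x≢y Hxy Hyx (indispensable min Hxy) (indispensable min Hyx) X?
           (Path.walk p)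
       | Exchange.exchange H⊆E conn (x≢y ∘ sym) Hyx Hxy (indispensable min Hyx) (indispensable min Hxy) Y?
           (Path.walk q)
  ... | inj₁ imp  | _         = no-improvement imp
  ... | _         | inj₁ imp  = no-improvement imp
  ... | inj₂ xy∈p | inj₂ yx∈q = twinless x y xy∈p yx∈q

improvement-minimum : {E H : EdgeSet n} → MinimumSC E H → (imp : Improvement E H) →
                      MinimumSC E (Improvement.graph imp)
improvement-minimum (_ , _ , least) imp =
  graph⊆E , connected , λ K K⊆E K-conn → ≤-trans size≤ (least K K⊆E K-conn)
  where open Improvement imp

-- Descent on the number k ≥ twinCount H of twin pairs: a twin-free minimum
-- subgraph is twinless; otherwise improve it and recurse.
TwinlessMinimum : EdgeSet n → Set
TwinlessMinimum {n} E = Σ (EdgeSet n) λ K → MinimumSC E K × TwinlessStronglyConnected K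

twinless-minimum : {E H : EdgeSet n} → Loopless E → TwinlessStronglyConnected E → (k : ℕ) →
                   MinimumSC E H → twinCount H ≤ k → DoubleNegation (TwinlessMinimum E)
descend : {E H : EdgeSet n} → Loopless E → TwinlessStronglyConnected E → (k : ℕ) →
          MinimumSC E H → twinCount H ≤ k → Improvement E H → DoubleNegation (TwinlessMinimum E)

twinless-minimum {H = H} loopless tsc k min bound none with twinPair? H
... | no twin-free = none (H , min , twinFree→twinless (proj₁ (proj₂ min))
                                       (λ c d Hcd Hdc → twin-free (c , d , Hcd , Hdc)))
... | yes (x , y , Hxy , Hyx) =
  improve loopless tsc min Hxy Hyx λ imp → descend loopless tsc k min bound imp none

descend loopless tsc zero    min bound imp = ⊥-elim (<⇒≱ (<-≤-trans (Improvement.fewerTwins imp) bound) z≤n)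
descend loopless tsc (suc k) min bound imp =
  twinless-minimum loopless tsc k (improvement-minimum min imp)
    (≤-pred (<-≤-trans (Improvement.fewerTwins imp) bound))

mainTheorem9 : (n : ℕ) (E : EdgeSet n) → Loopless E → TwinlessStronglyConnected E →
    (Et Es : EdgeSet n) → IsOptimalMTSCSS E Et → IsOptimalMSCSS E Es →
    edgeCount Et ≡ edgeCount Es
mainTheorem9 n E loopless tsc Et Es (Et⊆E , Et-tsc , Et-least) (Es⊆E , Es-sc , Es-least) =
  ≤-antisym Et≤Es Es≤Et
  where
  -- Twinless strong connectivity implies strong connectivity.
  Es≤Et : edgeCount Es ≤ edgeCount Et
  Es≤Et = Es-least Et Et⊆E (λ a b → proj₁ (Et-tsc a b))
  Es-minimum : MinimumSC E Es
  Es-minimum = Es⊆E , strong→connected Es-sc ,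
               λ K K⊆E K-conn → Es-least K K⊆E (connected→strong K-conn)
  through : TwinlessMinimum E → edgeCount Et ≤ edgeCount Es
  through (K , (K⊆E , _ , K-least) , K-tsc) =
    ≤-trans (Et-least K K⊆E K-tsc) (K-least Es Es⊆E (strong→connected Es-sc))
  Et≤Es : edgeCount Et ≤ edgeCount Es
  Et≤Es = decidable-stable (edgeCount Et ≤? edgeCount Es)
            (¬¬-map through (twinless-minimum loopless tsc _ Es-minimum ≤-refl))
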